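{- Let $G = G_1 \times G_2$ be a group of order $2^{2n}$ with $|G_1| = 2^{v_1}$ and $|G_2| = 2^{v_2}$, where $v_1$ and $v_2$ are even. Let $D_1$ be a difference set in $G_1$ and $D_2$ a difference set in $G_2$. Then the difference set \[D = \big(D_1 \times (G_2 - D_2)\big) \cup \big((G_1 - D_1) \times D_2\big)\] in $G$ has the symmetric difference property if and only if $D_1$ and $D_2$ both have the symmetric difference property.
   Context: A $(v,k,\lambda)$ difference set in a group $G$ of order $v$ is a subset $D \subseteq G$ with $|D| = k$ such that the multiset $\{d_1 d_2^{ -1} : d_1, d_2 \in D\}$ contains every non-identity element of $G$ exactly $\lambda$ times. The development of $D$ is the symmetric design whose points are the elements of $G$, whose blocks are the left translates $gD$ ($g \in G$), with incidence given by membership. A symmetric design has the symmetric difference property (SDP) if the symmetric difference $A \,\Delta\, B \,\Delta\, C$ of any three blocks (where $A \Delta B = (A-B)\cup(B-A)$) is either a block or the complement of a block; equivalently, the mod-2 sum of any three rows of its incidence matrix is a row or the complement of a row. A difference set is said to have the SDP if its development has the SDP. -}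

module Defs where

open import Data.Nat using (ℕ; zero; suc; _+_; _*_; _^_)
open import Data.Fin using (Fin)
import Data.Fin as Fin
open import Data.Fin.Properties using (*↔×)
open import Data.Bool using (Bool; true; false; if_then_else_; not; _xor_; _∧_)
open import Data.Product using (Σ; ∃; _×_; _,_; proj₁; proj₂)
open import Data.Sum using (_⊎_)
open import Function using (_∘_; _↔_; Inverse)
open import Function.Construct.Composition using (_↔-∘_)
open import Data.Product.Function.NonDependent.Propositional using (_×-↔_)
open import Relation.Binary.PropositionalEquality
  using (_≡_; _≢_; refl; cong; cong₂; isEquivalence)
open import Relation.Nullary.Decidable using (⌊_⌋)
open import Algebra.Structures using (IsGroup)

record FinGroup : Set₁ where
  field
    Carrier : Set
    _∙_     : Carrier → Carrier → Carrier
    ε       : Carrier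
    _⁻¹     : Carrier → Carrier
    isGroup : IsGroup _≡_ _∙_ ε _⁻¹
    order   : ℕ
    enum    : Fin order ↔ Carrier

  elt : Fin order → Carrier
  elt = Inverse.to enum

  _==_ : Carrier → Carrier → Bool
  x == y = ⌊ Inverse.from enum x Fin.≟ Inverse.from enum y ⌋

open FinGroup public

module _ (G₁ G₂ : FinGroup) where
  private
    module A = IsGroup (isGroup G₁)
    module B = IsGroup (isGroup G₂)
    C = Carrier G₁ × Carrier G₂
    _·_ : C → C → C
    (a , b) · (c , d) = (_∙_ G₁ a c , _∙_ G₂ b d)
    e : C
    e = (ε G₁ , ε G₂)
    i : C → C
    i (a , b) = (_⁻¹ G₁ a , _⁻¹ G₂ b)

    prodIsGroup : IsGroup _≡_ _·_ e i
    prodIsGroup = record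
      { isMonoid = record
        { isSemigroup = record
          { isMagma = record
            { isEquivalence = isEquivalence
            ; ∙-cong = λ { refl refl → refl } }
          ; assoc = λ x y z → cong₂ _,_ (A.assoc _ _ _) (B.assoc _ _ _) }
        ; identity = (λ x → cong₂ _,_ (A.identityˡ _) (B.identityˡ _))
                   , (λ x → cong₂ _,_ (A.identityʳ _) (B.identityʳ _)) }
      ; inverse = (λ x → cong₂ _,_ (A.inverseˡ _) (B.inverseˡ _))
                , (λ x → cong₂ _,_ (A.inverseʳ _) (B.inverseʳ _))
      ; ⁻¹-cong = λ { refl → refl } }

  _⊗_ : FinGroup
  _⊗_ = record
    { Carrier = C
    ; _∙_ = _·_
    ; ε = e
    ; _⁻¹ = i
    ; isGroup = prodIsGroup
    ; order = order G₁ * order G₂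
    ; enum = (enum G₁ ×-↔ enum G₂) ↔-∘ *↔× }

countFin : ∀ n → (Fin n → Bool) → ℕ
countFin zero    p = 0
countFin (suc n) p = (if p Fin.zero then 1 else 0) + countFin n (p ∘ Fin.suc)

sumFin : ∀ n → (Fin n → ℕ) → ℕ
sumFin zero    f = 0
sumFin (suc n) f = f Fin.zero + sumFin n (f ∘ Fin.suc)

Subset : FinGroup → Set
Subset G = Carrier G → Bool

card : (G : FinGroup) → Subset G → ℕ
card G D = countFin (order G) (D ∘ elt G)

diffCount : (G : FinGroup) → Subset G → Carrier G → ℕ
diffCount G D g =
  sumFin (order G) λ i → countFin (order G) λ j →
    D (elt G i) ∧ D (elt G j) ∧ (_==_ G (_∙_ G (elt G i) (_⁻¹ G (elt G j))) g)

IsDifferenceSet : (G : FinGroup) → Subset G → ℕ → ℕ → Set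
IsDifferenceSet G D k l =
  card G D ≡ k × (∀ g → g ≢ ε G → diffCount G D g ≡ l)

DifferenceSet : (G : FinGroup) → Subset G → Set
DifferenceSet G D = ∃ λ k → ∃ λ l → IsDifferenceSet G D k l

-- Development: the block indexed by g is the left translate gD,
-- x ∈ gD  ⇔  g⁻¹ x ∈ D.

block : (G : FinGroup) → Subset G → Carrier G → Subset G
block G D g x = D (_∙_ G (_⁻¹ G g) x)

HasSDP : (G : FinGroup) → Subset G → Set
HasSDP G D =
  ∀ a b c → ∃ λ g →
    (∀ x → (block G D a x xor block G D b x xor block G D c x) ≡ block G D g x)
    ⊎ (∀ x → (block G D a x xor block G D b x xor block G D c x) ≡ not (block G D g x))

productSet : (G₁ G₂ : FinGroup) → Subset G₁ → Subset G₂ → Subset (G₁ ⊗ G₂)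
productSet G₁ G₂ D₁ D₂ (x , y) =
  (D₁ x ∧ not (D₂ y)) Data.Bool.∨ (not (D₁ x) ∧ D₂ y)

{-# OPTIONS --safe #-}
-- Since (G₁ - D₁) × D₂ and D₁ × (G₂ - D₂) are disjoint, D is the set where χ_{D₁}(x₁) xor χ_{D₂}(x₂) holds,
-- and translation is componentwise, so every block of D is the xor of a block of D₁ and one of D₂.
-- Hence the xor of three blocks of D is the xor of three-block sums of the two factors. Writing
-- "block or complement of a block" as "block xor a constant", the constants of the factors add up,
-- and conversely fixing the second coordinate at ε turns the second factor into a constant.
module Submission where

open import Defs
open import Data.Nat using (ℕ; _*_; _^_)
open import Data.Nat.Divisibility using (_∣_)
open import Data.Bool using (Bool; true; false; not; _xor_; _∧_; _∨_)
open import Data.Bool.Properties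
  using (xor-assoc; xor-comm; xor-same; xor-identityʳ; true-xor; ∨-identityʳ; xor-∧-commutativeRing)
open import Data.Product using (_×_; _,_; ∃; ∃₂; map₂; uncurry)
open import Data.Sum using (_⊎_; inj₁; inj₂)
open import Function using (_⇔_; mk⇔; Equivalence)
open import Function.Construct.Composition using (_⇔-∘_)
open import Function.Construct.Symmetry using (⇔-sym)
open import Data.Product.Function.NonDependent.Propositional using (_×-⇔_)
open import Relation.Binary.PropositionalEquality using (_≡_; refl; sym; trans; cong; cong₂; module ≡-Reasoning)
open import Algebra.Bundles using (CommutativeRing)
open import Algebra.Properties.CommutativeSemigroup
  (CommutativeRing.+-commutativeSemigroup xor-∧-commutativeRing) using (interchange)

open ≡-Reasoning

blockSum : (G : FinGroup) → Subset G → (a b c : Carrier G) → Subset G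
blockSum G D a b c x = block G D a x xor block G D b x xor block G D c x

-- Adding the constant k is the identity for k = false and complementation for k = true.
HasSDP′ : (G : FinGroup) → Subset G → Set
HasSDP′ G D = ∀ a b c → ∃₂ λ g k → ∀ x → blockSum G D a b c x ≡ block G D g x xor k

xor-cancelʳ : ∀ x y → (x xor y) xor y ≡ x
xor-cancelʳ x y = begin
  (x xor y) xor y ≡⟨ xor-assoc x y y ⟩
  x xor (y xor y) ≡⟨ cong (x xor_) (xor-same y) ⟩
  x xor false     ≡⟨ xor-identityʳ x ⟩
  x               ∎

xor-as-∨ : ∀ a b → (a ∧ not b) ∨ (not a ∧ b) ≡ a xor b
xor-as-∨ false b = refl
xor-as-∨ true  b = ∨-identityʳ (not b)

xor-interchange₃ : ∀ p₁ q₁ p₂ q₂ p₃ q₃ →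
  (p₁ xor q₁) xor (p₂ xor q₂) xor (p₃ xor q₃) ≡ (p₁ xor p₂ xor p₃) xor (q₁ xor q₂ xor q₃)
xor-interchange₃ p₁ q₁ p₂ q₂ p₃ q₃ = begin
  (p₁ xor q₁) xor ((p₂ xor q₂) xor (p₃ xor q₃)) ≡⟨ cong ((p₁ xor q₁) xor_) (interchange p₂ q₂ p₃ q₃) ⟩
  (p₁ xor q₁) xor ((p₂ xor p₃) xor (q₂ xor q₃)) ≡⟨ interchange p₁ q₁ (p₂ xor p₃) (q₂ xor q₃) ⟩
  (p₁ xor p₂ xor p₃) xor (q₁ xor q₂ xor q₃)     ∎

xor-factorˡ : ∀ p q r s k → p xor q ≡ (r xor s) xor k → p ≡ r xor ((s xor k) xor q)
xor-factorˡ p q r s k eq = begin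
  p                           ≡⟨ sym (xor-cancelʳ p q) ⟩
  (p xor q) xor q             ≡⟨ cong (_xor q) eq ⟩
  ((r xor s) xor k) xor q     ≡⟨ cong (_xor q) (xor-assoc r s k) ⟩
  (r xor (s xor k)) xor q     ≡⟨ xor-assoc r (s xor k) q ⟩
  r xor ((s xor k) xor q)     ∎

xor-factorʳ : ∀ p q r s k → p xor q ≡ (r xor s) xor k → q ≡ s xor ((r xor k) xor p)
xor-factorʳ p q r s k eq = xor-factorˡ q p s r k (begin
  q xor p           ≡⟨ xor-comm q p ⟩
  p xor q           ≡⟨ eq ⟩
  (r xor s) xor k   ≡⟨ cong (_xor k) (xor-comm r s) ⟩
  (s xor r) xor k   ∎)

equal-or-complement⇔xor-constant : {A : Set} (f g : A → Bool) →
  ((∀ x → f x ≡ g x) ⊎ (∀ x → f x ≡ not (g x))) ⇔ (∃ λ k → ∀ x → f x ≡ g x xor k)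
equal-or-complement⇔xor-constant f g = mk⇔ to from
  where
  to : ((∀ x → f x ≡ g x) ⊎ (∀ x → f x ≡ not (g x))) → ∃ λ k → ∀ x → f x ≡ g x xor k
  to (inj₁ e) = false , λ x → trans (e x) (sym (xor-identityʳ (g x)))
  to (inj₂ e) = true , λ x → trans (e x) (trans (sym (true-xor (g x))) (xor-comm true (g x)))

  from : (∃ λ k → ∀ x → f x ≡ g x xor k) → (∀ x → f x ≡ g x) ⊎ (∀ x → f x ≡ not (g x))
  from (false , e) = inj₁ λ x → trans (e x) (xor-identityʳ (g x))
  from (true  , e) = inj₂ λ x → trans (e x) (trans (xor-comm (g x) true) (true-xor (g x)))

HasSDP⇔HasSDP′ : (G : FinGroup) (D : Subset G) → HasSDP G D ⇔ HasSDP′ G D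
HasSDP⇔HasSDP′ G D = mk⇔
  (λ s a b c → map₂ (λ {g} → Equivalence.to (triple≈block a b c g)) (s a b c))
  (λ s a b c → map₂ (λ {g} → Equivalence.from (triple≈block a b c g)) (s a b c))
  where
  triple≈block : ∀ a b c g →
    ((∀ x → blockSum G D a b c x ≡ block G D g x) ⊎ (∀ x → blockSum G D a b c x ≡ not (block G D g x)))
    ⇔ (∃ λ k → ∀ x → blockSum G D a b c x ≡ block G D g x xor k)
  triple≈block a b c g = equal-or-complement⇔xor-constant (blockSum G D a b c) (block G D g)

module _ (G₁ G₂ : FinGroup) (D₁ : Subset G₁) (D₂ : Subset G₂) where
  private
    G = G₁ ⊗ G₂
    D = productSet G₁ G₂ D₁ D₂

  block-⊗ : ∀ a₁ a₂ x₁ x₂ → block G D (a₁ , a₂) (x₁ , x₂) ≡ block G₁ D₁ a₁ x₁ xor block G₂ D₂ a₂ x₂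
  block-⊗ a₁ a₂ x₁ x₂ = xor-as-∨ (block G₁ D₁ a₁ x₁) (block G₂ D₂ a₂ x₂)

  blockSum-⊗ : ∀ a₁ a₂ b₁ b₂ c₁ c₂ x₁ x₂ →
    blockSum G D (a₁ , a₂) (b₁ , b₂) (c₁ , c₂) (x₁ , x₂)
      ≡ blockSum G₁ D₁ a₁ b₁ c₁ x₁ xor blockSum G₂ D₂ a₂ b₂ c₂ x₂
  blockSum-⊗ a₁ a₂ b₁ b₂ c₁ c₂ x₁ x₂ = begin
    blockSum G D (a₁ , a₂) (b₁ , b₂) (c₁ , c₂) (x₁ , x₂)
      ≡⟨ cong₂ _xor_ (block-⊗ a₁ a₂ x₁ x₂) (cong₂ _xor_ (block-⊗ b₁ b₂ x₁ x₂) (block-⊗ c₁ c₂ x₁ x₂)) ⟩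
    (block G₁ D₁ a₁ x₁ xor block G₂ D₂ a₂ x₂) xor (block G₁ D₁ b₁ x₁ xor block G₂ D₂ b₂ x₂)
      xor (block G₁ D₁ c₁ x₁ xor block G₂ D₂ c₂ x₂)
      ≡⟨ xor-interchange₃ (block G₁ D₁ a₁ x₁) (block G₂ D₂ a₂ x₂) (block G₁ D₁ b₁ x₁)
                          (block G₂ D₂ b₂ x₂) (block G₁ D₁ c₁ x₁) (block G₂ D₂ c₂ x₂) ⟩
    blockSum G₁ D₁ a₁ b₁ c₁ x₁ xor blockSum G₂ D₂ a₂ b₂ c₂ x₂ ∎

  shiftedBlock-⊗ : ∀ a₁ a₂ b₁ b₂ c₁ c₂ g₁ g₂ k →
    (∀ x → blockSum G D (a₁ , a₂) (b₁ , b₂) (c₁ , c₂) x ≡ block G D (g₁ , g₂) x xor k) →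
    ∀ x₁ x₂ → blockSum G₁ D₁ a₁ b₁ c₁ x₁ xor blockSum G₂ D₂ a₂ b₂ c₂ x₂
                ≡ (block G₁ D₁ g₁ x₁ xor block G₂ D₂ g₂ x₂) xor k
  shiftedBlock-⊗ a₁ a₂ b₁ b₂ c₁ c₂ g₁ g₂ k e x₁ x₂ = begin
    blockSum G₁ D₁ a₁ b₁ c₁ x₁ xor blockSum G₂ D₂ a₂ b₂ c₂ x₂
      ≡⟨ sym (blockSum-⊗ a₁ a₂ b₁ b₂ c₁ c₂ x₁ x₂) ⟩
    blockSum G D (a₁ , a₂) (b₁ , b₂) (c₁ , c₂) (x₁ , x₂)
      ≡⟨ e (x₁ , x₂) ⟩
    block G D (g₁ , g₂) (x₁ , x₂) xor k
      ≡⟨ cong (_xor k) (block-⊗ g₁ g₂ x₁ x₂) ⟩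
    (block G₁ D₁ g₁ x₁ xor block G₂ D₂ g₂ x₂) xor k ∎

  HasSDP′-⊗ : HasSDP′ G₁ D₁ → HasSDP′ G₂ D₂ → HasSDP′ G D
  HasSDP′-⊗ s₁ s₂ (a₁ , a₂) (b₁ , b₂) (c₁ , c₂) with s₁ a₁ b₁ c₁ | s₂ a₂ b₂ c₂
  ... | g₁ , k₁ , e₁ | g₂ , k₂ , e₂ = (g₁ , g₂) , k₁ xor k₂ , λ { (x₁ , x₂) → begin
    blockSum G D (a₁ , a₂) (b₁ , b₂) (c₁ , c₂) (x₁ , x₂)
      ≡⟨ blockSum-⊗ a₁ a₂ b₁ b₂ c₁ c₂ x₁ x₂ ⟩
    blockSum G₁ D₁ a₁ b₁ c₁ x₁ xor blockSum G₂ D₂ a₂ b₂ c₂ x₂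
      ≡⟨ cong₂ _xor_ (e₁ x₁) (e₂ x₂) ⟩
    (block G₁ D₁ g₁ x₁ xor k₁) xor (block G₂ D₂ g₂ x₂ xor k₂)
      ≡⟨ interchange (block G₁ D₁ g₁ x₁) k₁ (block G₂ D₂ g₂ x₂) k₂ ⟩
    (block G₁ D₁ g₁ x₁ xor block G₂ D₂ g₂ x₂) xor (k₁ xor k₂)
      ≡⟨ cong (_xor (k₁ xor k₂)) (sym (block-⊗ g₁ g₂ x₁ x₂)) ⟩
    block G D (g₁ , g₂) (x₁ , x₂) xor (k₁ xor k₂) ∎ }

  HasSDP′-⊗⇒₁ : HasSDP′ G D → HasSDP′ G₁ D₁
  HasSDP′-⊗⇒₁ s a b c with s (a , ε G₂) (b , ε G₂) (c , ε G₂)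
  ... | (g₁ , g₂) , k , e = g₁ , (t xor k) xor q , λ x₁ →
    xor-factorˡ (blockSum G₁ D₁ a b c x₁) q (block G₁ D₁ g₁ x₁) t k
      (shiftedBlock-⊗ a (ε G₂) b (ε G₂) c (ε G₂) g₁ g₂ k e x₁ (ε G₂))
    where
    q : Bool
    q = blockSum G₂ D₂ (ε G₂) (ε G₂) (ε G₂) (ε G₂)
    t : Bool
    t = block G₂ D₂ g₂ (ε G₂)

  HasSDP′-⊗⇒₂ : HasSDP′ G D → HasSDP′ G₂ D₂
  HasSDP′-⊗⇒₂ s a b c with s (ε G₁ , a) (ε G₁ , b) (ε G₁ , c)
  ... | (g₁ , g₂) , k , e = g₂ , (t xor k) xor p , λ x₂ →
    xor-factorʳ p (blockSum G₂ D₂ a b c x₂) t (block G₂ D₂ g₂ x₂) k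
      (shiftedBlock-⊗ (ε G₁) a (ε G₁) b (ε G₁) c g₁ g₂ k e (ε G₁) x₂)
    where
    p : Bool
    p = blockSum G₁ D₁ (ε G₁) (ε G₁) (ε G₁) (ε G₁)
    t : Bool
    t = block G₁ D₁ g₁ (ε G₁)

  HasSDP′-⊗⇔ : HasSDP′ G D ⇔ (HasSDP′ G₁ D₁ × HasSDP′ G₂ D₂)
  HasSDP′-⊗⇔ = mk⇔ (λ s → HasSDP′-⊗⇒₁ s , HasSDP′-⊗⇒₂ s) (uncurry HasSDP′-⊗)

  HasSDP-⊗⇔ : HasSDP G D ⇔ (HasSDP G₁ D₁ × HasSDP G₂ D₂)
  HasSDP-⊗⇔ =
    ⇔-sym (HasSDP⇔HasSDP′ G₁ D₁ ×-⇔ HasSDP⇔HasSDP′ G₂ D₂) ⇔-∘ (HasSDP′-⊗⇔ ⇔-∘ HasSDP⇔HasSDP′ G D)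

theorem3p1 : (n v₁ v₂ : ℕ) (G₁ G₂ : FinGroup) →
    order (G₁ ⊗ G₂) ≡ 2 ^ (2 * n) →
    order G₁ ≡ 2 ^ v₁ → order G₂ ≡ 2 ^ v₂ →
    2 ∣ v₁ → 2 ∣ v₂ →
    (D₁ : Subset G₁) (D₂ : Subset G₂) →
    DifferenceSet G₁ D₁ → DifferenceSet G₂ D₂ →
    HasSDP (G₁ ⊗ G₂) (productSet G₁ G₂ D₁ D₂) ⇔ (HasSDP G₁ D₁ × HasSDP G₂ D₂)
theorem3p1 _ _ _ G₁ G₂ _ _ _ _ _ D₁ D₂ _ _ = HasSDP-⊗⇔ G₁ G₂ D₁ D₂
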